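{- Let $\sigma$ be a signature and $\Delta\cup\{\alpha\}$ a set of $\mathcal{CO}[\sigma]$-formulas. Then $\Delta\models^g\alpha$ if and only if $\Delta\models^c\alpha$.
   Context: Signature $\sigma=(\mathrm{Dom},\mathrm{Ran})$: nonempty finite set of variables, each with a nonempty finite range. Assignments $s$ with $s(X)\in\mathrm{Ran}(X)$; $\mathbb A_\sigma$ their set. A system of functions $\mathcal F$ assigns to each $V\in\mathrm{En}(\mathcal F)\subseteq\mathrm{Dom}$ a set $PA_V^{\mathcal F}\subseteq\mathrm{Dom}\setminus\{V\}$ and $\mathcal F_V:\mathrm{Ran}(PA_V^{\mathcal F})\to\mathrm{Ran}(V)$; recursive if the graph with edges $(X,Y)$, $X\in PA_Y^{\mathcal F}$, is acyclic; $s$ compatible with $\mathcal F$ if $s(V)=\mathcal F_V(s(PA_V^{\mathcal F}))$ for $V\in\mathrm{En}(\mathcal F)$. Causal team: $(T^-,\mathcal F)$, $\mathcal F$ recursive, $T^-\subseteq\mathbb A_\sigma$ of compatible assignments; causal subteam: $(S^-,\mathcal F)$, $S^-\subseteq T^-$. Generalized causal team: a set $T$ of pairs $(s,\mathcal F)$ with $\mathcal F$ recursive and $s$ compatible; subteams are subsets; $T^-=\{s\mid(s,\mathcal F)\in T\}$. $\mathbf X=\mathbf x$: conjunction of equations, consistent if no variable gets two distinct values. Intervention (consistent): $\mathcal F_{\mathbf X=\mathbf x}$ = restriction of $\mathcal F$ to $\mathrm{En}(\mathcal F)\setminus\mathbf X$; $s_{\mathbf X=\mathbf x}(X_i)=x_i$,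 $s_{\mathbf X=\mathbf x}(V)=s(V)$ for $V\notin\mathrm{En}(\mathcal F)\cup\mathbf X$, $s_{\mathbf X=\mathbf x}(V)=\mathcal F_V(s_{\mathbf X=\mathbf x}(PA_V^{\mathcal F}))$ recursively otherwise; $T_{\mathbf X=\mathbf x}=(\{s_{\mathbf X=\mathbf x}\mid s\in T^-\},\mathcal F_{\mathbf X=\mathbf x})$ resp. $\{(s_{\mathbf X=\mathbf x},\mathcal F_{\mathbf X=\mathbf x})\mid(s,\mathcal F)\in T\}$. $\mathcal{CO}[\sigma]$: $\alpha::=X=x\mid\neg\alpha\mid\alpha\wedge\alpha\mid\alpha\vee\alpha\mid\mathbf X=\mathbf x\ \Box\!\!\rightarrow\alpha$. $\models^c$ on causal teams: $T\models X=x$ iff $s(X)=x$ for all $s\in T^-$; $T\models\neg\alpha$ iff $(\{s\},\mathcal F)\not\models\alpha$ for all $s\in T^-$; $\wedge$ usual; $T\models\varphi\vee\psi$ iff causal subteams $T_1,T_2$ with $T_1^-\cup T_2^-=T^-$, $T_1\models\varphi$, $T_2\models\psi$ exist; $T\models\mathbf X=\mathbf x\ \Box\!\!\rightarrow\varphi$ iff inconsistent or $T_{\mathbf X=\mathbf x}\models\varphi$. $\models^g$ on generalized causal teams: same, except $T\models^g\neg\alpha$ iff $\{(s,\mathcal F)\}\not\models^g\alpha$ for all $(s,\mathcal F)\in T$ and $T\models^g\varphi\vee\psi$ iff $T=T_1\cup T_2$ with $T_1\models^g\varphi$, $T_2\models^g\psi$. $\Delta\models^c\alpha$ (resp. $\Delta\models^g\alpha$):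 every causal team (resp. generalized causal team) over $\sigma$ satisfying all formulas in $\Delta$ satisfies $\alpha$. -}

module Defs where

open import Level using (0ℓ; Lift)
open import Data.Nat using (ℕ; NonZero)
open import Data.Fin using (Fin; _≟_)
open import Data.Bool using (Bool; true; false; _∧_; not)
open import Data.List using (List)
open import Data.Bool.ListAction using (any)
open import Data.List.NonEmpty using (List⁺; toList)
open import Data.List.Membership.Propositional using (_∈_)
open import Data.Product using (Σ; _×_; _,_; proj₁; ∃; ∃-syntax)
open import Data.Sum using (_⊎_)
open import Relation.Nullary using (¬_; does)
open import Relation.Binary.PropositionalEquality using (_≡_)
open import Relation.Binary.Construct.Closure.Transitive using (TransClosure)

-- Signatures: Dom = Fin n (nonempty), Ran X = Fin (ran X) (nonempty)

record Signature : Set where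
  field
    n      : ℕ
    ran    : Fin n → ℕ
    .{{n-nonzero}}   : NonZero n
    ran-nonzero : ∀ X → NonZero (ran X)

module _ (σ : Signature) where
  open Signature σ

  Var : Set
  Var = Fin n

  Val : Var → Set
  Val X = Fin (ran X)

  Assignment : Set
  Assignment = (X : Var) → Val X

  Eq : Set
  Eq = Σ Var Val

  -- systems of functions: En(F) as a boolean predicate, PA_V as a boolean
  -- predicate (pa V X = true iff X ∈ PA_V), PA_V ⊆ Dom \ {V}, and
  -- F_V : Ran(PA_V) → Ran(V), where an element of Ran(PA_V) is an assignment
  -- to the variables of PA_V.
  record System : Set where
    field
      en       : Var → Bool
      pa       : Var → Var → Bool
      pa-irrefl : ∀ V → pa V V ≡ false
      fun      : (V : Var) → ((X : Var) → pa V X ≡ true → Val X) → Val V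

  open System

  apply : System → (V : Var) → Assignment → Val V
  apply F V s = fun F V (λ X _ → s X)

  Edge : System → Var → Var → Set
  Edge F X Y = (en F Y ≡ true) × (pa F Y X ≡ true)

  Recursive : System → Set
  Recursive F = ∀ X → ¬ TransClosure (Edge F) X X

  Compatible : Assignment → System → Set
  Compatible s F = ∀ V → en F V ≡ true → s V ≡ apply F V s

  -- Formulas of CO[σ]; the antecedent X = x is a nonempty conjunction
  -- of equations, represented as a nonempty list.

  data CO : Set where
    eq   : (X : Var) → Val X → CO
    neg  : CO → CO
    and  : CO → CO → CO
    or   : CO → CO → CO
    cf   : List⁺ Eq → CO → CO

  Consistent : List⁺ Eq → Set
  Consistent xs = ∀ {X : Var} {x x′ : Val X} →
    (X , x) ∈ toList xs → (X , x′) ∈ toList xs → x ≡ x′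

  inX : Var → List⁺ Eq → Bool
  inX V xs = any (λ p → does (proj₁ p ≟ V)) (toList xs)

  restrict : System → List⁺ Eq → System
  restrict F xs = record
    { en = λ V → en F V ∧ not (inX V xs)
    ; pa = pa F
    ; pa-irrefl = pa-irrefl F
    ; fun = fun F
    }

  -- s′ = s_{X=x}: the (unique, by recursiveness of F) assignment satisfying
  -- the defining recursive equations of the intervention.
  record Intervened (F : System) (xs : List⁺ Eq) (s s′ : Assignment) : Set where
    field
      onX  : ∀ {V : Var} {x : Val V} → (V , x) ∈ toList xs → s′ V ≡ x
      exo  : ∀ V → en F V ≡ false → inX V xs ≡ false → s′ V ≡ s V
      endo : ∀ V → en F V ≡ true → inX V xs ≡ false → s′ V ≡ apply F V s′

  -- Causal teams (T⁻ , F), with T⁻ a subset of 𝔸_σ given as a predicate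

  Team : Set₁
  Team = Assignment → Set

  IsCausalTeam : Team → System → Set
  IsCausalTeam T F = Recursive F × (∀ s → T s → Compatible s F)

  interveneC : Team → System → List⁺ Eq → Team
  interveneC T F xs s′ = ∃[ s ] (T s × Intervened F xs s s′)

  singletonC : Assignment → Team
  singletonC s t = t ≡ s

  _⊆C_ : Team → Team → Set
  T₁ ⊆C T = ∀ s → T₁ s → T s

  satC : CO → Team → System → Set₁
  satC (eq X x)  T F = Lift _ (∀ s → T s → s X ≡ x)
  satC (neg α)   T F = ∀ s → T s → ¬ satC α (singletonC s) F
  satC (and α β) T F = satC α T F × satC β T F
  satC (or α β)  T F = ∃[ T₁ ] ∃[ T₂ ]
    (T₁ ⊆C T × T₂ ⊆C T × (∀ s → T s → T₁ s ⊎ T₂ s) × satC α T₁ F × satC β T₂ F)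
  satC (cf xs α) T F = ¬ Consistent xs ⊎ satC α (interveneC T F xs) (restrict F xs)

  -- Generalized causal teams: sets of pairs (s , F), as predicates

  GTeam : Set₁
  GTeam = Assignment → System → Set

  IsGenCausalTeam : GTeam → Set
  IsGenCausalTeam T = ∀ s F → T s F → Recursive F × Compatible s F

  interveneG : GTeam → List⁺ Eq → GTeam
  interveneG T xs s′ F′ =
    ∃[ s ] ∃[ F ] (T s F × F′ ≡ restrict F xs × Intervened F xs s s′)

  singletonG : Assignment → System → GTeam
  singletonG s F t G = (t ≡ s) × (G ≡ F)

  _⊆G_ : GTeam → GTeam → Set
  T₁ ⊆G T = ∀ s F → T₁ s F → T s F

  satG : CO → GTeam → Set₁
  satG (eq X x)  T = Lift _ (∀ s F → T s F → s X ≡ x)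
  satG (neg α)   T = ∀ s F → T s F → ¬ satG α (singletonG s F)
  satG (and α β) T = satG α T × satG β T
  satG (or α β)  T = ∃[ T₁ ] ∃[ T₂ ]
    (T₁ ⊆G T × T₂ ⊆G T × (∀ s F → T s F → T₁ s F ⊎ T₂ s F) × satG α T₁ × satG β T₂)
  satG (cf xs α) T = ¬ Consistent xs ⊎ satG α (interveneG T xs)

  _⊨ᶜ_ : (CO → Set) → CO → Set₁
  Δ ⊨ᶜ α = ∀ T F → IsCausalTeam T F → (∀ β → Δ β → satC β T F) → satC α T F

  _⊨ᵍ_ : (CO → Set) → CO → Set₁
  Δ ⊨ᵍ α = ∀ T → IsGenCausalTeam T → (∀ β → Δ β → satG β T) → satG α T

module Submission where

-- Both team semantics of CO[σ] are flat: a (generalized) causal team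
-- satisfies α exactly when each of its members, taken on its own,
-- satisfies α.  Satisfaction by a single member (s , F) is given by a
-- classical pointwise semantics `Holds`, where a counterfactual
-- X = x □→ α holds at (s , F) if α holds at every intervened assignment
-- s_{X=x} under F_{X=x}, provided X = x is consistent.
--
-- With flatness,
-- both entailment relations reduce to the pointwise one: a causal team
-- (T⁻ , F) is the generalized team T⁻ × {F}, and every member (s , F) of a
-- generalized causal team gives the causal team ({s} , F).

open import Defs
open import Function.Bundles using (_⇔_; mk⇔)
open import Level using (lift; lower)
open import Data.Fin using (_≟_)
open import Data.List using (List)
open import Data.List.NonEmpty using (List⁺; toList)
open import Data.List.Membership.Propositional using (_∈_)
open import Data.List.Relation.Unary.All as All using (All; all?)
open import Data.Product using (_×_; _,_; proj₁; proj₂)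
open import Data.Product.Properties using (≡-dec)
open import Data.Sum using (_⊎_; inj₁; inj₂)
open import Data.Empty using (⊥-elim)
open import Relation.Nullary using (¬_; Dec; yes; no)
open import Relation.Nullary.Decidable using (map′)
open import Relation.Binary.PropositionalEquality using (_≡_; refl; cong)

module CausalTeams (σ : Signature) where

  Agree : Eq σ → Eq σ → Set
  Agree p q = proj₁ p ≡ proj₁ q → p ≡ q

  agree? : ∀ p q → Dec (Agree p q)
  agree? p q with proj₁ p ≟ proj₁ q
  ... | no  X≢Y = yes (λ X≡Y → ⊥-elim (X≢Y X≡Y))
  ... | yes X≡Y = map′ (λ p≡q _ → p≡q) (λ agr → agr X≡Y) (≡-dec _≟_ _≟_ p q)

  ConsistentList : List (Eq σ) → Set
  ConsistentList L = ∀ {X : Var σ} {x x′ : Val σ X} → (X , x) ∈ L → (X , x′) ∈ L → x ≡ x′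

  consistent⇒pairwise : ∀ L → ConsistentList L → All (λ p → All (Agree p) L) L
  consistent⇒pairwise L cons =
    All.tabulate (λ {p} p∈L → All.tabulate (λ {q} q∈L → agree p q p∈L q∈L))
    where
    agree : ∀ p q → p ∈ L → q ∈ L → Agree p q
    agree (X , x) (.X , y) p∈L q∈L refl = cong (X ,_) (cons p∈L q∈L)

  pairwise⇒consistent : ∀ L → All (λ p → All (Agree p) L) L → ConsistentList L
  pairwise⇒consistent L pairwise p∈L q∈L =
    value-injective (All.lookup (All.lookup pairwise p∈L) q∈L refl)
    where
    value-injective : ∀ {X : Var σ} {x x′ : Val σ X} →
                      _≡_ {A = Eq σ} (X , x) (X , x′) → x ≡ x′
    value-injective refl = refl

  consistent? : ∀ (xs : List⁺ (Eq σ)) → Dec (Consistent σ xs)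
  consistent? xs with all? (λ p → all? (agree? p) (toList xs)) (toList xs)
  ... | yes pairwise = yes (λ p∈ q∈ → pairwise⇒consistent (toList xs) pairwise p∈ q∈)
  ... | no ¬pairwise = no (λ cons → ¬pairwise (consistent⇒pairwise (toList xs) (λ p∈ q∈ → cons p∈ q∈)))

  Holds : CO σ → Assignment σ → System σ → Set
  Holds (eq X x)  s F = s X ≡ x
  Holds (neg α)   s F = ¬ Holds α s F
  Holds (and α β) s F = Holds α s F × Holds β s F
  Holds (or α β)  s F = Holds α s F ⊎ Holds β s F
  Holds (cf xs α) s F =
    Consistent σ xs → ∀ s′ → Intervened σ F xs s s′ → Holds α s′ (restrict σ F xs)

  HoldsAllG : CO σ → GTeam σ → Set
  HoldsAllG α T = ∀ s F → T s F → Holds α s F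

  HoldsAllC : CO σ → Team σ → System σ → Set
  HoldsAllC α T F = ∀ s → T s → Holds α s F

  satG⇒holdsAll : ∀ α T → satG σ α T → HoldsAllG α T
  holdsAll⇒satG : ∀ α T → HoldsAllG α T → satG σ α T

  satG⇒holdsAll (eq X x) T sat s F t = lower sat s F t
  satG⇒holdsAll (neg α) T sat s F t holds =
    sat s F t (holdsAll⇒satG α _ (λ { _ _ (refl , refl) → holds }))
  satG⇒holdsAll (and α β) T (satα , satβ) s F t =
    satG⇒holdsAll α T satα s F t , satG⇒holdsAll β T satβ s F t
  satG⇒holdsAll (or α β) T (T₁ , T₂ , _ , _ , cover , satα , satβ) s F t with cover s F t
  ... | inj₁ t₁ = inj₁ (satG⇒holdsAll α T₁ satα s F t₁)
  ... | inj₂ t₂ = inj₂ (satG⇒holdsAll β T₂ satβ s F t₂)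
  satG⇒holdsAll (cf xs α) T (inj₁ incons) s F t cons = ⊥-elim (incons cons)
  satG⇒holdsAll (cf xs α) T (inj₂ sat) s F t cons s′ iv =
    satG⇒holdsAll α _ sat s′ (restrict σ F xs) (s , F , t , refl , iv)

  holdsAll⇒satG (eq X x) T holds = lift holds
  holdsAll⇒satG (neg α) T holds s F t sat =
    holds s F t (satG⇒holdsAll α _ sat s F (refl , refl))
  holdsAll⇒satG (and α β) T holds =
    holdsAll⇒satG α T (λ s F t → proj₁ (holds s F t)) ,
    holdsAll⇒satG β T (λ s F t → proj₂ (holds s F t))
  holdsAll⇒satG (or α β) T holds =
    Tα , Tβ , (λ _ _ → proj₁) , (λ _ _ → proj₁) , cover ,
    holdsAll⇒satG α Tα (λ _ _ → proj₂) , holdsAll⇒satG β Tβ (λ _ _ → proj₂)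
    where
    Tα Tβ : GTeam σ
    Tα s F = T s F × Holds α s F
    Tβ s F = T s F × Holds β s F
    cover : ∀ s F → T s F → Tα s F ⊎ Tβ s F
    cover s F t with holds s F t
    ... | inj₁ a = inj₁ (t , a)
    ... | inj₂ b = inj₂ (t , b)
  holdsAll⇒satG (cf xs α) T holds with consistent? xs
  ... | no incons = inj₁ incons
  ... | yes cons  = inj₂ (holdsAll⇒satG α _ λ { s′ _ (s , F , t , refl , iv) → holds s F t cons s′ iv })

  satC⇒holdsAll : ∀ α T F → satC σ α T F → HoldsAllC α T F
  holdsAll⇒satC : ∀ α T F → HoldsAllC α T F → satC σ α T F

  satC⇒holdsAll (eq X x) T F sat s t = lower sat s t
  satC⇒holdsAll (neg α) T F sat s t holds =
    sat s t (holdsAll⇒satC α _ F (λ { _ refl → holds }))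
  satC⇒holdsAll (and α β) T F (satα , satβ) s t =
    satC⇒holdsAll α T F satα s t , satC⇒holdsAll β T F satβ s t
  satC⇒holdsAll (or α β) T F (T₁ , T₂ , _ , _ , cover , satα , satβ) s t with cover s t
  ... | inj₁ t₁ = inj₁ (satC⇒holdsAll α T₁ F satα s t₁)
  ... | inj₂ t₂ = inj₂ (satC⇒holdsAll β T₂ F satβ s t₂)
  satC⇒holdsAll (cf xs α) T F (inj₁ incons) s t cons = ⊥-elim (incons cons)
  satC⇒holdsAll (cf xs α) T F (inj₂ sat) s t cons s′ iv =
    satC⇒holdsAll α _ _ sat s′ (s , t , iv)

  holdsAll⇒satC (eq X x) T F holds = lift holds
  holdsAll⇒satC (neg α) T F holds s t sat =
    holds s t (satC⇒holdsAll α _ F sat s refl)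
  holdsAll⇒satC (and α β) T F holds =
    holdsAll⇒satC α T F (λ s t → proj₁ (holds s t)) ,
    holdsAll⇒satC β T F (λ s t → proj₂ (holds s t))
  holdsAll⇒satC (or α β) T F holds =
    Tα , Tβ , (λ _ → proj₁) , (λ _ → proj₁) , cover ,
    holdsAll⇒satC α Tα F (λ _ → proj₂) , holdsAll⇒satC β Tβ F (λ _ → proj₂)
    where
    Tα Tβ : Team σ
    Tα s = T s × Holds α s F
    Tβ s = T s × Holds β s F
    cover : ∀ s → T s → Tα s ⊎ Tβ s
    cover s t with holds s t
    ... | inj₁ a = inj₁ (t , a)
    ... | inj₂ b = inj₂ (t , b)
  holdsAll⇒satC (cf xs α) T F holds with consistent? xs
  ... | no incons = inj₁ incons
  ... | yes cons  = inj₂ (holdsAll⇒satC α _ _ λ { s′ (s , t , iv) → holds s t cons s′ iv })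

  -- The causal team (T⁻ , F) seen as the generalized team T⁻ × {F}; it
  -- has the same members and hence, by flatness, satisfies the same
  -- formulas.
  asGTeam : Team σ → System σ → GTeam σ
  asGTeam T F s F′ = T s × F′ ≡ F

  asGTeam-isGen : ∀ T F → IsCausalTeam σ T F → IsGenCausalTeam σ (asGTeam T F)
  asGTeam-isGen T F (recursive , compatible) s _ (t , refl) = recursive , compatible s t

  asGTeam-sat : ∀ α T F → satC σ α T F → satG σ α (asGTeam T F)
  asGTeam-sat α T F sat = holdsAll⇒satG α _ (λ { s _ (t , refl) → satC⇒holdsAll α T F sat s t })

  member-isCausal : ∀ T s F → IsGenCausalTeam σ T → T s F →
                    IsCausalTeam σ (singletonC σ s) F
  member-isCausal T s F isGen t =
    proj₁ (isGen s F t) , (λ { _ refl → proj₂ (isGen s F t) })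

  member-sat : ∀ α T s F → T s F → satG σ α T → satC σ α (singletonC σ s) F
  member-sat α T s F t sat = holdsAll⇒satC α _ F (λ { _ refl → satG⇒holdsAll α T sat s F t })

  -- Generalized consequence implies causal consequence: evaluate the
  -- generalized entailment on T⁻ × {F}.
  ⊨ᵍ⇒⊨ᶜ : ∀ Δ α → _⊨ᵍ_ σ Δ α → _⊨ᶜ_ σ Δ α
  ⊨ᵍ⇒⊨ᶜ Δ α entails T F isCausal satΔ =
    holdsAll⇒satC α T F (λ s t →
      satG⇒holdsAll α G (entails G (asGTeam-isGen T F isCausal) satΔ′) s F (t , refl))
    where
    G : GTeam σ
    G = asGTeam T F
    satΔ′ : ∀ β → Δ β → satG σ β G
    satΔ′ β δ = asGTeam-sat β T F (satΔ β δ)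

  -- Causal consequence implies generalized consequence: evaluate the
  -- causal entailment on each member ({s} , F) separately.
  ⊨ᶜ⇒⊨ᵍ : ∀ Δ α → _⊨ᶜ_ σ Δ α → _⊨ᵍ_ σ Δ α
  ⊨ᶜ⇒⊨ᵍ Δ α entails T isGen satΔ = holdsAll⇒satG α T λ s F t →
    satC⇒holdsAll α (singletonC σ s) F
      (entails (singletonC σ s) F (member-isCausal T s F isGen t)
               (λ β δ → member-sat β T s F t (satΔ β δ)))
      s refl

corollary2p12 : (σ : Signature) (Δ : CO σ → Set) (α : CO σ) →
                (_⊨ᵍ_ σ Δ α) ⇔ (_⊨ᶜ_ σ Δ α)
corollary2p12 σ Δ α = mk⇔ (⊨ᵍ⇒⊨ᶜ Δ α) (⊨ᶜ⇒⊨ᵍ Δ α)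
  where open CausalTeams σ
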